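{- Let $M$ be a finite structure whose vocabulary has maximum relation arity $k$, and let $X_1,\ldots,X_{k+1}$, $Z$ be as constructed below. Then on $Z$ the three relations $\equiv_{X_k}$, $\equiv_{X_{k+1}}$ and $\sim$ coincide.
   Context: $M$ has universe $V=V(M)$ of size $n$ and relations $R^M:V^l\to\{0,1\}$. $a\sim b$ means the transposition of $a$ and $b$ is an automorphism of $M$. For $X\subseteq V$ and $a,b\in V\setminus X$, $a\equiv_X b$ means the identity on $X$ extended by $a\mapsto b$ is an isomorphism from $M[X\cup\{a\}]$ to $M[X\cup\{b\}]$; $\mathcal C(X)$ is the set of $\equiv_X$-classes and $\mathcal C^m(X)=\{C\in\mathcal C(X):|C|\le m\}$. Transformation $T$: if there is $S\subseteq V\setminus X$ with $|S|\le k-1$ and $|\mathcal C(X\cup S)|>|\mathcal C(X)|$, take the lexicographically first such $S$ (with respect to a fixed ordering) and set $T(X)=X\cup S$; otherwise $T$ is not applicable. $E(X)$ is obtained from $X$ by applying $T$ iteratively as long as it is applicable ($E(X)=X$ if $T$ is not applicable to $X$). Let $Y(X)=\bigcup_{C\in\mathcal C^{k+1}(X)}C$. Set $X_0=Y_0=\emptyset$; $X_i=E(X_{i-1}\cup Y_{i-1})$ and $Y_i=Y(X_i)$ for $1\le i\le k$; $X_{k+1}=X_k\cup Y_k$; $Z=V\setminus X_{k+1}$. -}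

module Defs where

open import Data.Nat as ℕ using (ℕ; zero; suc; _≤_; _<_; _∸_; _+_)
import Data.Nat.Properties as ℕP
open import Data.Bool using (Bool; true; false; if_then_else_; _∧_)
open import Data.Fin as Fin using (Fin)
open import Data.Fin.Properties using (_≟_; all?)
import Data.Fin.Properties as FinP
open import Data.Fin.Subset using (Subset; _∈_; _∉_; _∪_; ⁅_⁆; ⊥)
open import Data.Fin.Subset.Properties using (_∈?_)
open import Data.Vec as Vec using (Vec; []; _∷_)
open import Data.Vec.Relation.Unary.All as VAll using (All)
open import Data.List as List using (List; []; _∷_; _++_; length; filter; allFin)
open import Data.Maybe using (Maybe; just; nothing)
open import Data.Product using (_×_; _,_; proj₁; proj₂; ∃)
open import Relation.Nullary using (Dec; yes; no; ¬_; ¬?; _×-dec_; _→-dec_)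
open import Relation.Nullary.Decidable using (⌊_⌋)
open import Relation.Binary.PropositionalEquality using (_≡_)
import Data.Bool.Properties as BoolP

record Structure (n : ℕ) : Set where
  field
    m     : ℕ
    arity : Fin m → ℕ
    rel   : (r : Fin m) → Vec (Fin n) (arity r) → Bool
open Structure public

MaxArity : ∀ {n} → Structure n → ℕ → Set
MaxArity M k = (∀ r → arity M r ≤ k) × ∃ (λ r → arity M r ≡ k)

mapTo : ∀ {n} → Fin n → Fin n → Fin n → Fin n
mapTo a b v = if ⌊ v ≟ a ⌋ then b else v

swap : ∀ {n} → Fin n → Fin n → Fin n → Fin n
swap a b v = if ⌊ v ≟ a ⌋ then b else (if ⌊ v ≟ b ⌋ then a else v)

Sim : ∀ {n} → Structure n → Fin n → Fin n → Set
Sim {n} M a b = ∀ r (t : Vec (Fin n) (arity M r)) →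
  rel M r t ≡ rel M r (Vec.map (swap a b) t)

-- a ≡_X b : a, b ∉ X and the identity on X extended by a ↦ b is an
-- isomorphism M[X ∪ {a}] → M[X ∪ {b}]  (it is automatically a bijection
-- X ∪ {a} → X ∪ {b} since a, b ∉ X, so only preservation of the relations
-- on tuples from X ∪ {a} needs to be required).
EquivAt : ∀ {n} → Structure n → Subset n → Fin n → Fin n → Set
EquivAt M X a b = a ∉ X × b ∉ X ×
  (∀ r (t : Vec _ (arity M r)) → All (λ v → v ∈ X ∪ ⁅ a ⁆) t →
     rel M r t ≡ rel M r (Vec.map (mapTo a b) t))

allVec? : ∀ {n} l {P : Vec (Fin n) l → Set} →
          (∀ t → Dec (P t)) → Dec (∀ t → P t)
allVec? zero P? with P? []
... | yes p = yes λ { [] → p }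
... | no ¬p = no λ f → ¬p (f [])
allVec? (suc l) {P} P? with all? (λ x → allVec? l (λ xs → P? (x ∷ xs)))
... | yes p = yes λ { (x ∷ xs) → p x xs }
... | no ¬p = no λ f → ¬p (λ x xs → f (x ∷ xs))

¬∈? : ∀ {n} (x : Fin n) (X : Subset n) → Dec (x ∉ X)
¬∈? x X = ¬? (x ∈? X)

EquivAt? : ∀ {n} (M : Structure n) X a b → Dec (EquivAt M X a b)
EquivAt? M X a b =
  ¬∈? a X ×-dec ¬∈? b X ×-dec
  all? (λ r → allVec? (arity M r) (λ t →
    VAll.all? (λ v → v ∈? (X ∪ ⁅ a ⁆)) t →-dec
    BoolP._≟_ (rel M r t) (rel M r (Vec.map (mapTo a b) t))))

count : ∀ {n} {P : Fin n → Set} → (∀ v → Dec (P v)) → ℕ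
count P? = length (filter P? (allFin _))

IsLeastRep : ∀ {n} → Structure n → Subset n → Fin n → Set
IsLeastRep M X v = v ∉ X × (∀ w → w Fin.< v → ¬ EquivAt M X w v)

IsLeastRep? : ∀ {n} (M : Structure n) X v → Dec (IsLeastRep M X v)
IsLeastRep? M X v =
  ¬∈? v X ×-dec all? (λ w → (w FinP.<? v) →-dec ¬? (EquivAt? M X w v))

-- |𝒞(X)| : number of ≡_X classes (≡_X is an equivalence relation on
-- V ∖ X, so classes are counted by their least elements)
numClasses : ∀ {n} → Structure n → Subset n → ℕ
numClasses M X = count (IsLeastRep? M X)

classSize : ∀ {n} → Structure n → Subset n → Fin n → ℕ
classSize M X v = count (λ w → EquivAt? M X w v)

Yset : ∀ {n} → Structure n → ℕ → Subset n → Subset n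
Yset M k X = Vec.tabulate λ v →
  ⌊ ¬∈? v X ⌋ ∧ ⌊ classSize M X v ℕ.≤? suc k ⌋

-- Candidate sets S in lexicographic order (w.r.t. the natural order of
-- Fin n): strictly increasing sequences, compared lexicographically.

incNE : (n : ℕ) → List (List (Fin n))   -- nonempty increasing sequences
incNE zero    = []
incNE (suc n) =
  List.map (Fin.zero ∷_) ([] ∷ List.map (List.map Fin.suc) (incNE n))
  ++ List.map (List.map Fin.suc) (incNE n)

lexSets : (n : ℕ) → List (List (Fin n))
lexSets n = [] ∷ incNE n

toSubset : ∀ {n} → List (Fin n) → Subset n
toSubset = List.foldr (λ x s → ⁅ x ⁆ ∪ s) ⊥

Admissible : ∀ {n} → Structure n → ℕ → Subset n → List (Fin n) → Set
Admissible M k X S =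
  Data.List.Relation.Unary.All.All (λ v → v ∉ X) S ×
  length S ≤ k ∸ 1 ×
  numClasses M X < numClasses M (X ∪ toSubset S)
  where import Data.List.Relation.Unary.All

Admissible? : ∀ {n} (M : Structure n) k X S → Dec (Admissible M k X S)
Admissible? M k X S =
  LAll.all? (λ v → ¬∈? v X) S ×-dec
  (length S ℕ.≤? k ∸ 1) ×-dec
  (numClasses M X ℕ.<? numClasses M (X ∪ toSubset S))
  where import Data.List.Relation.Unary.All as LAll

Tstep : ∀ {n} → Structure n → ℕ → Subset n → Maybe (Subset n)
Tstep {n} M k X with List.head (filter (Admissible? M k X) (lexSets n))
... | just S  = just (X ∪ toSubset S)
... | nothing = nothing

iterT : ∀ {n} → Structure n → ℕ → ℕ → Subset n → Subset n
iterT M k zero    X = X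
iterT M k (suc f) X with Tstep M k X
... | just X' = iterT M k f X'
... | nothing = X

-- E(X).  Each application of T increases |𝒞(·)| ≤ n, so T is applied at
-- most n times; fuel n + 1 therefore always reaches the fixpoint.
Eclos : ∀ {n} → Structure n → ℕ → Subset n → Subset n
Eclos {n} M k X = iterT M k (suc n) X

XY : ∀ {n} → Structure n → ℕ → ℕ → Subset n × Subset n
XY M k zero    = ⊥ , ⊥
XY M k (suc i) =
  let X' = Eclos M k (proj₁ (XY M k i) ∪ proj₂ (XY M k i))
  in X' , Yset M k X'

Xseq : ∀ {n} → Structure n → ℕ → ℕ → Subset n
Xseq M k i = proj₁ (XY M k i)

Yseq : ∀ {n} → Structure n → ℕ → ℕ → Subset n
Yseq M k i = proj₂ (XY M k i)

Xfinal : ∀ {n} → Structure n → ℕ → Subset n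
Xfinal M k = Xseq M k k ∪ Yseq M k k

InZ : ∀ {n} → Structure n → ℕ → Fin n → Set
InZ M k v = v ∉ Xfinal M k

module Submission where

-- Only ≡_{X_k} ⇒ ∼ needs work: ≡_X becomes coarser as X shrinks, and an
-- automorphism swapping a, b ∉ X witnesses a ≡_X b.  Let u ≡_{X_k} v and let
-- t be a tuple avoiding v.  The sets X_i ∪ Y_i increase and Y_{i+1} is
-- disjoint from X_i ∪ Y_i, so the at most k − 1 entries of t other than u
-- all avoid Y_{i+1} for some i < k.  The entries S outside X_{i+1} then lie in
-- ≡_{X_{i+1}}-classes with more than k + 1 elements, so every class keeps an
-- element outside S; were the class of u and v split by passing to
-- X_{i+1} ∪ S, the number of classes would grow and T would apply to
-- X_{i+1}.  Hence u ≡ v over X_{i+1} ∪ S, which is exactly what moving u to v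
-- in t requires.  Finally, when a and b both occur in t, the transposition
-- (a b) acts on t as three such moves a ↦ c, b ↦ a, c ↦ b through an element
-- c of the class of a not occurring in t; it exists because a ∉ Y_k.

open import Defs
open import Data.Nat as ℕ
  using (ℕ; zero; suc; _≤_; _<_; _∸_; _+_; z≤n; s≤s; _≤′_; ≤′-refl; ≤′-step)
import Data.Nat.Properties as ℕP
open import Data.Fin as Fin using (Fin)
import Data.Fin.Properties as FinP
open import Data.Fin.Subset using (Subset; _∈_; _∉_; _∪_; ⁅_⁆; _⊆_)
open import Data.Fin.Subset.Properties using (_∈?_)
import Data.Fin.Subset.Properties as SubsetP
open import Data.Vec as Vec using (Vec; []; _∷_)
import Data.Vec.Properties as VecP
open import Data.Vec.Relation.Unary.All using (All; []; _∷_)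
import Data.Vec.Relation.Unary.All as VAll
import Data.Vec.Relation.Unary.All.Properties as VAllP
open import Data.List as List using (List; []; _∷_; length; filter; allFin)
import Data.List.Properties as ListP
open import Data.List.Relation.Unary.Any using (Any; here; there)
import Data.List.Relation.Unary.Any as Any
import Data.List.Relation.Unary.Any.Properties as AnyP
import Data.List.Relation.Unary.All as LAll
import Data.List.Relation.Unary.All.Properties as LAllP
open import Data.List.Relation.Unary.AllPairs as AllPairs using (AllPairs)
import Data.List.Relation.Unary.AllPairs.Properties as AllPairsP
open import Data.List.Relation.Unary.Unique.Propositional using (Unique)
import Data.List.Relation.Unary.Unique.Propositional.Properties as UniqueP
open import Data.List.Membership.Propositional using (find) renaming (_∈_ to _∈ₗ_; _∉_ to _∉ₗ_)
open import Data.List.Membership.Propositional.Properties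
  using (∈-lookup; ∈-filter⁺; ∈-filter⁻; ∈-allFin; ∈-map⁺; ∈-map⁻; ∈-++⁺ˡ; ∈-++⁺ʳ)
open import Data.Bool.Properties using (T-≡; T-∧)
open import Data.Maybe using (Maybe; just; nothing)
open import Data.Sum using (_⊎_; inj₁; inj₂)
open import Data.Product using (_×_; _,_; proj₁; proj₂; ∃; ∃-syntax)
open import Data.Empty using (⊥-elim)
open import Level using (0ℓ)
open import Relation.Nullary using (Dec; yes; no; ¬_; ¬?; _×-dec_; _→-dec_)
open import Relation.Nullary.Decidable using (toWitness; fromWitness)
open import Relation.Unary using (Pred; Decidable; _≐_)
open import Relation.Binary using (Rel; IsPartialEquivalence; tri<; tri≈; tri>)
import Relation.Binary as B
open import Relation.Binary.PropositionalEquality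
  using (_≡_; _≢_; refl; sym; trans; cong; cong₂; subst; module ≡-Reasoning)
open import Function using (_∘_; id; case_of_)
open import Function.Bundles using (_⇔_; mk⇔; Equivalence)

private variable
  A : Set
  n l : ℕ

_∈ₗ?_ : (v : Fin n) (xs : List (Fin n)) → Dec (v ∈ₗ xs)
v ∈ₗ? xs = Any.any? (v FinP.≟_) xs

Unique-lookup-injective : ∀ {xs : List A} → Unique xs → ∀ i j →
                          List.lookup xs i ≡ List.lookup xs j → i ≡ j
Unique-lookup-injective (_ AllPairs.∷ _) Fin.zero Fin.zero _ = refl
Unique-lookup-injective (x≢xs AllPairs.∷ _) Fin.zero (Fin.suc j) eq =
  ⊥-elim (LAll.lookup x≢xs (∈-lookup j) eq)
Unique-lookup-injective (x≢xs AllPairs.∷ _) (Fin.suc i) Fin.zero eq =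
  ⊥-elim (LAll.lookup x≢xs (∈-lookup i) (sym eq))
Unique-lookup-injective (_ AllPairs.∷ xs!) (Fin.suc i) (Fin.suc j) eq =
  cong Fin.suc (Unique-lookup-injective xs! i j eq)

module _ {P Q : Pred A 0ℓ} (P? : Decidable P) (Q? : Decidable Q)
         (P⇒Q : ∀ {x} → P x → Q x) where

  length-filter-mono : ∀ xs → length (filter P? xs) ≤ length (filter Q? xs)
  length-filter-mono [] = z≤n
  length-filter-mono (x ∷ xs) with P? x | Q? x
  ... | yes _  | yes _  = s≤s (length-filter-mono xs)
  ... | yes px | no ¬qx = ⊥-elim (¬qx (P⇒Q px))
  ... | no _   | yes _  = ℕP.m≤n⇒m≤1+n (length-filter-mono xs)
  ... | no _   | no _   = length-filter-mono xs

  length-filter-mono-< : ∀ {y xs} → y ∈ₗ xs → ¬ P y → Q y →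
                         length (filter P? xs) < length (filter Q? xs)
  length-filter-mono-< {xs = x ∷ xs} (here refl) ¬py qy with P? x | Q? x
  ... | yes px | _      = ⊥-elim (¬py px)
  ... | no _   | yes _  = s≤s (length-filter-mono xs)
  ... | no _   | no ¬qy = ⊥-elim (¬qy qy)
  length-filter-mono-< {xs = x ∷ xs} (there y∈xs) ¬py qy with P? x | Q? x
  ... | yes _  | yes _  = s≤s (length-filter-mono-< y∈xs ¬py qy)
  ... | yes px | no ¬qx = ⊥-elim (¬qx (P⇒Q px))
  ... | no _   | yes _  = ℕP.m≤n⇒m≤1+n (length-filter-mono-< y∈xs ¬py qy)
  ... | no _   | no _   = length-filter-mono-< y∈xs ¬py qy

module _ {P : Pred (Fin n) 0ℓ} (P? : Decidable P) where

  count-≤-injection : ∀ {xs : List A} (f : ∀ {v} → P v → A) → (∀ {v} (p : P v) → f p ∈ₗ xs) →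
                      (∀ {v w} (p : P v) (q : P w) → f p ≡ f q → v ≡ w) →
                      count P? ≤ length xs
  count-≤-injection {xs = xs} f f∈xs f-injective = FinP.injective⇒≤ {f = position} position-injective
    where
    enum : Fin (count P?) → Fin n
    enum = List.lookup (filter P? (allFin n))
    enum-P : ∀ i → P (enum i)
    enum-P i = proj₂ (∈-filter⁻ P? {xs = allFin n} (∈-lookup i))
    position : Fin (count P?) → Fin (length xs)
    position i = Any.index (f∈xs (enum-P i))
    position-injective : ∀ {i j} → position i ≡ position j → i ≡ j
    position-injective {i} {j} eq =
      Unique-lookup-injective (UniqueP.filter⁺ P? (UniqueP.allFin⁺ n)) i j
        (f-injective (enum-P i) (enum-P j)
          (trans (AnyP.lookup-index (f∈xs (enum-P i)))
            (trans (cong (List.lookup xs) eq) (sym (AnyP.lookup-index (f∈xs (enum-P j)))))))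

  count-≤-length : ∀ {xs} → (∀ {v} → P v → v ∈ₗ xs) → count P? ≤ length xs
  count-≤-length P⊆xs = count-≤-injection (λ {v} _ → v) P⊆xs (λ _ _ eq → eq)

  count≤n : count P? ≤ n
  count≤n = ℕP.≤-trans (ListP.length-filter P? (allFin n)) (ℕP.≤-reflexive (ListP.length-tabulate id))

  count-escapes : ∀ {xs} → length xs < count P? → ∃[ v ] P v × v ∉ₗ xs
  count-escapes {xs} xs<P with FinP.any? (λ v → P? v ×-dec ¬? (v ∈ₗ? xs))
  ... | yes found = found
  ... | no ¬found = ⊥-elim (ℕP.<⇒≱ xs<P (count-≤-length in-xs))
    where
    in-xs : ∀ {v} → P v → v ∈ₗ xs
    in-xs {v} pv with v ∈ₗ? xs
    ... | yes v∈xs = v∈xs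
    ... | no v∉xs  = ⊥-elim (¬found (v , pv , v∉xs))

module _ {P Q : Pred (Fin n) 0ℓ} (P? : Decidable P) (Q? : Decidable Q) where

  count-≐ : P ≐ Q → count P? ≡ count Q?
  count-≐ P≐Q = cong length (ListP.filter-≐ P? Q? P≐Q (allFin n))

  count-<-injection : (f : ∀ {v} → P v → Fin n) → (∀ {v} (p : P v) → Q (f p)) →
                      (∀ {v w} (p : P v) (q : P w) → f p ≡ f q → v ≡ w) →
                      ∀ {w₀} → Q w₀ → (∀ {v} (p : P v) → f p ≢ w₀) → count P? < count Q?
  count-<-injection f f-Q f-injective {w₀} qw₀ f≢w₀ = ℕP.≤-<-trans
    (count-≤-injection P? f
      (λ p → ∈-filter⁺ (_≢? w₀) (∈-filter⁺ Q? (∈-allFin _) (f-Q p)) (f≢w₀ p)) f-injective)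
    (ListP.filter-notAll (_≢? w₀) (filter Q? (allFin n))
      (Any.map (λ { refl ≢w₀ → ≢w₀ refl }) (∈-filter⁺ Q? (∈-allFin w₀) qw₀)))
    where
    _≢?_ : ∀ v w → Dec (v ≢ w)
    v ≢? w = ¬? (v FinP.≟ w)

Least : Pred (Fin n) 0ℓ → Pred (Fin n) 0ℓ
Least P m = P m × (∀ w → w Fin.< m → ¬ P w)

least : ∀ {P : Pred (Fin n) 0ℓ} → Decidable P → ∃ P → ∃ (Least P)
least {suc n} P? (w , pw) with P? Fin.zero
... | yes p0 = Fin.zero , p0 , λ _ ()
least {suc n} P? (Fin.zero , pw) | no ¬p0 = ⊥-elim (¬p0 pw)
least {suc n} P? (Fin.suc w , pw) | no ¬p0 with least (λ v → P? (Fin.suc v)) (w , pw)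
... | m , pm , below-m = Fin.suc m , pm , below-suc-m
  where
  below-suc-m : ∀ w → w Fin.< Fin.suc m → ¬ _
  below-suc-m Fin.zero    _         = ¬p0
  below-suc-m (Fin.suc w) (s≤s w<m) = below-m w w<m

Least-unique : ∀ {P : Pred (Fin n) 0ℓ} {m m′} → Least P m → Least P m′ → m ≡ m′
Least-unique {m = m} {m′} (pm , below-m) (pm′ , below-m′) with FinP.<-cmp m m′
... | tri< m<m′ _ _ = ⊥-elim (below-m′ m m<m′ pm)
... | tri≈ _ m≡m′ _ = m≡m′
... | tri> _ _ m′<m = ⊥-elim (below-m m′ m′<m pm′)

Least-≐ : ∀ {P Q : Pred (Fin n) 0ℓ} {m} → P ≐ Q → Least P m → Least Q m
Least-≐ (P⊆Q , Q⊆P) (pm , below-m) = P⊆Q pm , λ w w<m qw → below-m w w<m (Q⊆P qw)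

module Classes {R : Rel (Fin n) 0ℓ} (R? : B.Decidable R) (R-per : IsPartialEquivalence R) where
  open IsPartialEquivalence R-per using () renaming (sym to R-sym; trans to R-trans)

  IsRep : Pred (Fin n) 0ℓ
  IsRep v = Least (λ w → R w v) v

  IsRep? : Decidable IsRep
  IsRep? v = R? v v ×-dec FinP.all? (λ w → (w FinP.<? v) →-dec ¬? (R? w v))

  #classes : ℕ
  #classes = count IsRep?

  reflˡ : ∀ {u v} → R u v → R u u
  reflˡ Ruv = R-trans Ruv (R-sym Ruv)

  class-≐ : ∀ {u v} → R u v → (λ w → R w u) ≐ (λ w → R w v)
  class-≐ Ruv = (λ Rwu → R-trans Rwu Ruv) , (λ Rwv → R-trans Rwv (R-sym Ruv))

  rep : ∀ {v} → R v v → ∃[ r ] IsRep r × R r v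
  rep Rvv with least (λ w → R? w _) (_ , Rvv)
  ... | r , Rrv , below-r = r , Least-≐ (class-≐ (R-sym Rrv)) (Rrv , below-r) , Rrv

  rep-unique : ∀ {r r′} → IsRep r → IsRep r′ → R r r′ → r ≡ r′
  rep-unique r-rep r′-rep Rrr′ = Least-unique (Least-≐ (class-≐ Rrr′) r-rep) r′-rep

-- Sending each R-class to its least element in the domain of R′ is injective,
-- and misses the R′-class of whichever of u, v is not R′-related to the image
-- of their common R-class.
module Refinement {R R′ : Rel (Fin n) 0ℓ} (R? : B.Decidable R) (R′? : B.Decidable R′)
                  (R-per : IsPartialEquivalence R) (R′-per : IsPartialEquivalence R′)
                  (R′⇒R : ∀ {u v} → R′ u v → R u v)
                  (cover : ∀ {r} → R r r → ∃[ m ] R m r × R′ m m) where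
  private
    module C  = Classes R? R-per
    module C′ = Classes R′? R′-per
    module R  = IsPartialEquivalence R-per
    module R′ = IsPartialEquivalence R′-per

  Survives : Fin n → Pred (Fin n) 0ℓ
  Survives r m = R m r × R′ m m

  least-survivor : ∀ {r} → C.IsRep r → ∃ (Least (Survives r))
  least-survivor r-rep = least (λ m → R? m _ ×-dec R′? m m) (cover (proj₁ r-rep))

  survivor : ∀ {r} → C.IsRep r → Fin n
  survivor = proj₁ ∘ least-survivor

  survivor-rep : ∀ {r} (r-rep : C.IsRep r) → C′.IsRep (survivor r-rep)
  survivor-rep r-rep with least-survivor r-rep
  ... | m , (Rmr , R′mm) , below-m =
    R′mm , λ w w<m R′wm → below-m w w<m (R.trans (R′⇒R R′wm) Rmr , C′.reflˡ R′wm)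

  survivor-injective : ∀ {r r′} (p : C.IsRep r) (q : C.IsRep r′) → survivor p ≡ survivor q → r ≡ r′
  survivor-injective p q _ with least-survivor p | least-survivor q
  survivor-injective p q refl | _ , (Rmr , _) , _ | _ , (Rmr′ , _) , _ =
    C.rep-unique p q (R.trans (R.sym Rmr) Rmr′)

  survivor-cong : ∀ {r r′} (p : C.IsRep r) (q : C.IsRep r′) → R r r′ → survivor p ≡ survivor q
  survivor-cong p q Rrr′ =
    Least-unique (Least-≐ Survives-≐ (proj₂ (least-survivor p))) (proj₂ (least-survivor q))
    where
    Survives-≐ : Survives _ ≐ Survives _
    Survives-≐ = (λ (Rmr , R′mm) → R.trans Rmr Rrr′ , R′mm)
               , (λ (Rmr′ , R′mm) → R.trans Rmr′ (R.sym Rrr′) , R′mm)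

  #classes-<-witness : ∀ {r₀ z} (r₀-rep : C.IsRep r₀) → R′ z z → R z r₀ →
                       ¬ R′ (survivor r₀-rep) z → C.#classes < C′.#classes
  #classes-<-witness {z = z} r₀-rep R′zz Rzr₀ ¬R′m₀z with C′.rep R′zz
  ... | w₀ , w₀-rep , R′w₀z =
    count-<-injection C.IsRep? C′.IsRep? survivor survivor-rep survivor-injective w₀-rep misses
    where
    misses : ∀ {r} (r-rep : C.IsRep r) → survivor r-rep ≢ w₀
    misses {r} r-rep m≡w₀ = ¬R′m₀z (subst (λ m → R′ m z) (survivor-cong r-rep r₀-rep Rrr₀) R′mz)
      where
      R′mz : R′ (survivor r-rep) z
      R′mz = subst (λ m → R′ m z) (sym m≡w₀) R′w₀z
      Rmr : R (survivor r-rep) r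
      Rmr = proj₁ (proj₁ (proj₂ (least-survivor r-rep)))
      Rrr₀ : R r _
      Rrr₀ = R.trans (R.sym Rmr) (R.trans (R′⇒R R′mz) Rzr₀)

  #classes-< : ∀ {u v} → R u v → R′ u u → R′ v v → ¬ R′ u v → C.#classes < C′.#classes
  #classes-< Ruv R′uu R′vv ¬R′uv with C.rep (C.reflˡ Ruv)
  ... | r₀ , r₀-rep , Rr₀u with R′? (survivor r₀-rep) _
  ...   | no ¬R′m₀u = #classes-<-witness r₀-rep R′uu (R.sym Rr₀u) ¬R′m₀u
  ...   | yes R′m₀u = #classes-<-witness r₀-rep R′vv (R.trans (R.sym Ruv) (R.sym Rr₀u))
                        (λ R′m₀v → ¬R′uv (R′.trans (R′.sym R′m₀u) R′m₀v))

mapTo-≡ : (a b : Fin n) → mapTo a b a ≡ b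
mapTo-≡ a b with a FinP.≟ a
... | yes _   = refl
... | no a≢a = ⊥-elim (a≢a refl)

mapTo-≢ : ∀ (a b : Fin n) {v} → v ≢ a → mapTo a b v ≡ v
mapTo-≢ a b {v} v≢a with v FinP.≟ a
... | yes v≡a = ⊥-elim (v≢a v≡a)
... | no _    = refl

mapTo-self : (a v : Fin n) → mapTo a a v ≡ v
mapTo-self a v with v FinP.≟ a
... | yes v≡a = sym v≡a
... | no _    = refl

swap-≡ˡ : (a b : Fin n) → swap a b a ≡ b
swap-≡ˡ a b with a FinP.≟ a
... | yes _   = refl
... | no a≢a = ⊥-elim (a≢a refl)

swap-≡ʳ : (a b : Fin n) → swap a b b ≡ a
swap-≡ʳ a b with b FinP.≟ a
... | yes refl = refl
... | no _     = mapTo-≡ b a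

swap-≢ : ∀ (a b : Fin n) {v} → v ≢ a → v ≢ b → swap a b v ≡ v
swap-≢ a b {v} v≢a v≢b with v FinP.≟ a
... | yes v≡a = ⊥-elim (v≢a v≡a)
... | no _    = mapTo-≢ b a v≢b

swap-self : (a v : Fin n) → swap a a v ≡ v
swap-self a v with v FinP.≟ a
... | yes v≡a = sym v≡a
... | no _    = refl

mapTo≡swap : ∀ (a b : Fin n) {v} → v ≢ b → mapTo a b v ≡ swap a b v
mapTo≡swap a b {v} v≢b with v FinP.≟ a
... | yes _ = refl
... | no _  = sym (mapTo-≢ b a v≢b)

mapTo≡swap-flip : ∀ (a b : Fin n) {v} → v ≢ a → mapTo b a v ≡ swap a b v
mapTo≡swap-flip a b {v} v≢a with v FinP.≟ a
... | yes v≡a = ⊥-elim (v≢a v≡a)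
... | no _    = refl

mapTo-avoids : ∀ {a c : Fin n} → c ≢ a → ∀ x → mapTo a c x ≢ a
mapTo-avoids {a = a} c≢a x with x FinP.≟ a
... | yes refl = c≢a
... | no x≢a   = x≢a

three-moves≡swap : ∀ {a b c : Fin n} → c ≢ a → c ≢ b →
                   ∀ {x} → x ≢ c → mapTo c b (mapTo b a (mapTo a c x)) ≡ swap a b x
three-moves≡swap {a = a} {b} {c} c≢a c≢b {x} x≢c = by-cases (x FinP.≟ a) (x FinP.≟ b)
  where
  open ≡-Reasoning
  by-cases : Dec (x ≡ a) → Dec (x ≡ b) → mapTo c b (mapTo b a (mapTo a c x)) ≡ swap a b x
  by-cases (yes refl) _ = begin
    mapTo c b (mapTo b x (mapTo x c x)) ≡⟨ cong (mapTo c b ∘ mapTo b x) (mapTo-≡ x c) ⟩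
    mapTo c b (mapTo b x c)             ≡⟨ cong (mapTo c b) (mapTo-≢ b x c≢b) ⟩
    mapTo c b c                         ≡⟨ mapTo-≡ c b ⟩
    b                                   ≡⟨ swap-≡ˡ x b ⟨
    swap x b x                          ∎
  by-cases (no x≢a) (yes refl) = begin
    mapTo c x (mapTo x a (mapTo a c x)) ≡⟨ cong (mapTo c x ∘ mapTo x a) (mapTo-≢ a c x≢a) ⟩
    mapTo c x (mapTo x a x)             ≡⟨ cong (mapTo c x) (mapTo-≡ x a) ⟩
    mapTo c x a                         ≡⟨ mapTo-≢ c x (c≢a ∘ sym) ⟩
    a                                   ≡⟨ swap-≡ʳ a x ⟨
    swap a x x                          ∎
  by-cases (no x≢a) (no x≢b) = begin
    mapTo c b (mapTo b a (mapTo a c x)) ≡⟨ cong (mapTo c b ∘ mapTo b a) (mapTo-≢ a c x≢a) ⟩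
    mapTo c b (mapTo b a x)             ≡⟨ cong (mapTo c b) (mapTo-≢ b a x≢b) ⟩
    mapTo c b x                         ≡⟨ mapTo-≢ c b x≢c ⟩
    x                                   ≡⟨ swap-≢ a b x≢a x≢b ⟨
    swap a b x                          ∎

map-cong-All : ∀ {f g : Fin n → Fin n} {t : Vec (Fin n) l} →
               All (λ x → f x ≡ g x) t → Vec.map f t ≡ Vec.map g t
map-cong-All []          = refl
map-cong-All (fx≡gx ∷ t) = cong₂ _∷_ fx≡gx (map-cong-All t)

All-∈ : ∀ {P : Fin n → Set} (t : Vec (Fin n) l) → (∀ {x} → x ∈ₗ Vec.toList t → P x) → All P t
All-∈ t h = VAllP.toList⁻ (LAll.tabulate h)

map-cong-∈ : ∀ {f g : Fin n → Fin n} (t : Vec (Fin n) l) →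
             (∀ {x} → x ∈ₗ Vec.toList t → f x ≡ g x) → Vec.map f t ≡ Vec.map g t
map-cong-∈ {f = f} {g} t f≡g = map-cong-All (All-∈ {P = λ x → f x ≡ g x} t f≡g)

∉-map-mapTo : ∀ {a c : Fin n} → c ≢ a → (t : Vec (Fin n) l) →
              a ∉ₗ Vec.toList (Vec.map (mapTo a c) t)
∉-map-mapTo c≢a t a∈ with ∈-map⁻ _ (subst (_ ∈ₗ_) (VecP.toList-map _ t) a∈)
... | x , _ , a≡ = mapTo-avoids c≢a x (sym a≡)

∈-∪⁅⁆⁻ : ∀ {X : Subset n} {a x} → x ∈ X ∪ ⁅ a ⁆ → x ∈ X ⊎ x ≡ a
∈-∪⁅⁆⁻ {X = X} {a} x∈ with SubsetP.x∈p∪q⁻ X ⁅ a ⁆ x∈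
... | inj₁ x∈X   = inj₁ x∈X
... | inj₂ x∈⁅a⁆ = inj₂ (SubsetP.x∈⁅y⁆⇒x≡y a x∈⁅a⁆)

∈-∪⁅⁆ˡ : ∀ {X : Subset n} {a x} → x ∈ X → x ∈ X ∪ ⁅ a ⁆
∈-∪⁅⁆ˡ x∈X = SubsetP.x∈p∪q⁺ (inj₁ x∈X)

∈-∪⁅⁆ʳ : ∀ {X : Subset n} {a} → a ∈ X ∪ ⁅ a ⁆
∈-∪⁅⁆ʳ {a = a} = SubsetP.x∈p∪q⁺ (inj₂ (SubsetP.x∈⁅x⁆ a))

∈⇒≢ : ∀ {X : Subset n} {x a} → x ∈ X → a ∉ X → x ≢ a
∈⇒≢ x∈X a∉X refl = a∉X x∈X

module _ {X : Subset n} {a b : Fin n} (a∉X : a ∉ X) (b∉X : b ∉ X) where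

  mapTo-∈ : ∀ {x} → x ∈ X ∪ ⁅ a ⁆ → mapTo a b x ∈ X ∪ ⁅ b ⁆
  mapTo-∈ {x} x∈ with ∈-∪⁅⁆⁻ x∈
  ... | inj₁ x∈X  =
    subst (_∈ X ∪ ⁅ b ⁆) (sym (mapTo-≢ a b (∈⇒≢ x∈X a∉X))) (∈-∪⁅⁆ˡ x∈X)
  ... | inj₂ refl = subst (_∈ X ∪ ⁅ b ⁆) (sym (mapTo-≡ a b)) ∈-∪⁅⁆ʳ

  mapTo-∘ : ∀ c {x} → x ∈ X ∪ ⁅ a ⁆ → mapTo b c (mapTo a b x) ≡ mapTo a c x
  mapTo-∘ c {x} x∈ with ∈-∪⁅⁆⁻ x∈
  ... | inj₁ x∈X = begin
    mapTo b c (mapTo a b x) ≡⟨ cong (mapTo b c) (mapTo-≢ a b (∈⇒≢ x∈X a∉X)) ⟩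
    mapTo b c x             ≡⟨ mapTo-≢ b c (∈⇒≢ x∈X b∉X) ⟩
    x                       ≡⟨ mapTo-≢ a c (∈⇒≢ x∈X a∉X) ⟨
    mapTo a c x             ∎
    where open ≡-Reasoning
  ... | inj₂ refl = begin
    mapTo b c (mapTo x b x) ≡⟨ cong (mapTo b c) (mapTo-≡ x b) ⟩
    mapTo b c b             ≡⟨ mapTo-≡ b c ⟩
    c                       ≡⟨ mapTo-≡ x c ⟨
    mapTo x c x             ∎
    where open ≡-Reasoning

  swap≡mapTo-on : ∀ {x} → x ∈ X ∪ ⁅ a ⁆ → swap a b x ≡ mapTo a b x
  swap≡mapTo-on {x} x∈ with ∈-∪⁅⁆⁻ x∈
  ... | inj₁ x∈X  = sym (mapTo≡swap a b (∈⇒≢ x∈X b∉X))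
  ... | inj₂ refl = trans (swap-≡ˡ x b) (sym (mapTo-≡ x b))

module _ (M : Structure n) where
  open ≡-Reasoning

  EquivAt-refl : ∀ {X a} → a ∉ X → EquivAt M X a a
  EquivAt-refl {a = a} a∉X = a∉X , a∉X , λ r t _ →
    cong (rel M r) (sym (trans (VecP.map-cong (mapTo-self a) t) (VecP.map-id t)))

  EquivAt-trans : ∀ {X a b c} → EquivAt M X a b → EquivAt M X b c → EquivAt M X a c
  EquivAt-trans {X} {a} {b} {c} (a∉X , b∉X , a↦b) (_ , c∉X , b↦c) = a∉X , c∉X , λ r t t⊆ → begin
    rel M r t
      ≡⟨ a↦b r t t⊆ ⟩
    rel M r (Vec.map (mapTo a b) t)
      ≡⟨ b↦c r _ (VAllP.gmap (mapTo-∈ a∉X b∉X) t⊆) ⟩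
    rel M r (Vec.map (mapTo b c) (Vec.map (mapTo a b) t))
      ≡⟨ cong (rel M r) (VecP.map-∘ _ _ t) ⟨
    rel M r (Vec.map (mapTo b c ∘ mapTo a b) t)
      ≡⟨ cong (rel M r) (map-cong-All (VAll.map (mapTo-∘ a∉X b∉X c) t⊆)) ⟩
    rel M r (Vec.map (mapTo a c) t)
      ∎

  EquivAt-sym : ∀ {X a b} → EquivAt M X a b → EquivAt M X b a
  EquivAt-sym {X} {a} {b} (a∉X , b∉X , a↦b) = b∉X , a∉X , λ r t t⊆ → begin
    rel M r t
      ≡⟨ cong (rel M r) (round-trip t⊆) ⟨
    rel M r (Vec.map (mapTo a b) (Vec.map (mapTo b a) t))
      ≡⟨ a↦b r _ (VAllP.gmap (mapTo-∈ b∉X a∉X) t⊆) ⟨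
    rel M r (Vec.map (mapTo b a) t)
      ∎
    where
    round-trip : ∀ {l} {t : Vec _ l} → All (_∈ X ∪ ⁅ b ⁆) t →
                 Vec.map (mapTo a b) (Vec.map (mapTo b a) t) ≡ t
    round-trip {t = t} t⊆ = begin
      Vec.map (mapTo a b) (Vec.map (mapTo b a) t) ≡⟨ VecP.map-∘ _ _ t ⟨
      Vec.map (mapTo a b ∘ mapTo b a) t
        ≡⟨ map-cong-All (VAll.map (mapTo-∘ b∉X a∉X b) t⊆) ⟩
      Vec.map (mapTo b b) t                       ≡⟨ VecP.map-cong (mapTo-self b) t ⟩
      Vec.map id t                                ≡⟨ VecP.map-id t ⟩
      t                                           ∎

  EquivAt-isPartialEquivalence : ∀ X → IsPartialEquivalence (EquivAt M X)
  EquivAt-isPartialEquivalence X = record { sym = EquivAt-sym ; trans = EquivAt-trans }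

  EquivAt-antitone : ∀ {X X′ a b} → X ⊆ X′ → EquivAt M X′ a b → EquivAt M X a b
  EquivAt-antitone {X} {X′} {a} X⊆X′ (a∉X′ , b∉X′ , a↦b) =
    a∉X′ ∘ X⊆X′ , b∉X′ ∘ X⊆X′ , λ r t t⊆ → a↦b r t (VAll.map widen t⊆)
    where
    widen : ∀ {x} → x ∈ X ∪ ⁅ a ⁆ → x ∈ X′ ∪ ⁅ a ⁆
    widen x∈ with ∈-∪⁅⁆⁻ x∈
    ... | inj₁ x∈X  = ∈-∪⁅⁆ˡ (X⊆X′ x∈X)
    ... | inj₂ refl = ∈-∪⁅⁆ʳ

  Sim⇒EquivAt : ∀ {X a b} → a ∉ X → b ∉ X → Sim M a b → EquivAt M X a b
  Sim⇒EquivAt a∉X b∉X a∼b = a∉X , b∉X , λ r t t⊆ →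
    trans (a∼b r t) (cong (rel M r) (map-cong-All (VAll.map (swap≡mapTo-on a∉X b∉X) t⊆)))

  module ClassesAt (X : Subset n) = Classes (EquivAt? M X) (EquivAt-isPartialEquivalence X)

  numClasses≡#classes : ∀ X → numClasses M X ≡ ClassesAt.#classes X
  numClasses≡#classes X = count-≐ (IsLeastRep? M X) (ClassesAt.IsRep? X)
    ((λ (v∉X , below) → EquivAt-refl v∉X , below) , (λ (Evv , below) → proj₁ Evv , below))

toSubset-∈⁻ : ∀ {xs : List (Fin n)} {v} → v ∈ toSubset xs → v ∈ₗ xs
toSubset-∈⁻ {xs = []}     v∈ = ⊥-elim (SubsetP.∉⊥ v∈)
toSubset-∈⁻ {xs = x ∷ xs} v∈ with SubsetP.x∈p∪q⁻ ⁅ x ⁆ (toSubset xs) v∈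
... | inj₁ v∈⁅x⁆ = here (SubsetP.x∈⁅y⁆⇒x≡y x v∈⁅x⁆)
... | inj₂ v∈xs  = there (toSubset-∈⁻ v∈xs)

toSubset-∈⁺ : ∀ {xs : List (Fin n)} {v} → v ∈ₗ xs → v ∈ toSubset xs
toSubset-∈⁺ (here refl)  = SubsetP.x∈p∪q⁺ (inj₁ (SubsetP.x∈⁅x⁆ _))
toSubset-∈⁺ (there v∈xs) = SubsetP.x∈p∪q⁺ (inj₂ (toSubset-∈⁺ v∈xs))

elements : Subset n → List (Fin n)
elements S = filter (_∈? S) (allFin _)

∈-elements⁻ : ∀ {S : Subset n} {v} → v ∈ₗ elements S → v ∈ S
∈-elements⁻ {S = S} = proj₂ ∘ ∈-filter⁻ (_∈? S) {xs = allFin _}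

∈-elements⁺ : ∀ {S : Subset n} {v} → v ∈ S → v ∈ₗ elements S
∈-elements⁺ {S = S} = ∈-filter⁺ (_∈? S) (∈-allFin _)

toSubset-elements : (S : Subset n) → toSubset (elements S) ≡ S
toSubset-elements S =
  SubsetP.⊆-antisym (∈-elements⁻ ∘ toSubset-∈⁻) (toSubset-∈⁺ ∘ ∈-elements⁺)

elements-increasing : (S : Subset n) → AllPairs Fin._<_ (elements S)
elements-increasing S = AllPairsP.filter⁺ (_∈? S) (AllPairsP.tabulate⁺-< id)

positive⇒map-suc : ∀ {xs : List (Fin (suc n))} → LAll.All (Fin.zero {n} Fin.<_) xs →
                   ∃[ ys ] xs ≡ List.map (Fin.suc {n}) ys
positive⇒map-suc {xs = []} _ = [] , refl
positive⇒map-suc {xs = Fin.suc y ∷ _} (_ LAll.∷ 0<xs)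
  with ys , refl ← positive⇒map-suc 0<xs = y ∷ ys , refl

increasing-unsuc : ∀ {ys : List (Fin n)} →
                   AllPairs Fin._<_ (List.map Fin.suc ys) → AllPairs Fin._<_ ys
increasing-unsuc = AllPairs.map ℕ.s<s⁻¹ ∘ AllPairsP.map⁻

∈-lexSets : ∀ {xs : List (Fin n)} → AllPairs Fin._<_ xs → xs ∈ₗ lexSets n
∈-lexSets {xs = []} _ = here refl
∈-lexSets {suc n} {Fin.zero ∷ _} (0<xs AllPairs.∷ xs↑) with ys , refl ← positive⇒map-suc 0<xs =
  there (∈-++⁺ˡ (∈-map⁺ (Fin.zero ∷_)
    (∈-map⁺ (List.map Fin.suc) (∈-lexSets (increasing-unsuc xs↑)))))
∈-lexSets {suc n} {Fin.suc x ∷ xs} xs↑@(sx<xs AllPairs.∷ _)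
  with x ∷ ys , refl ← positive⇒map-suc (ℕ.z<s LAll.∷ LAll.map (ℕP.<-trans ℕ.z<s) sx<xs)
  with ∈-lexSets (increasing-unsuc {ys = x ∷ ys} xs↑)
... | there ys∈ = there (∈-++⁺ʳ _ (∈-map⁺ (List.map Fin.suc) ys∈))

module Iteration (step : A → Maybe A) where

  iterate : ℕ → A → A
  iterate zero       x = x
  iterate (suc fuel) x with step x
  ... | just y  = iterate fuel y
  ... | nothing = x

  iterate-preserves : ∀ {_≼_ : A → A → Set} →
                      (∀ {x} → x ≼ x) → (∀ {x y z} → x ≼ y → y ≼ z → x ≼ z) →
                      (∀ {x y} → step x ≡ just y → x ≼ y) → ∀ fuel x → x ≼ iterate fuel x
  iterate-preserves ≼-refl ≼-trans step-≼ zero x = ≼-refl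
  iterate-preserves ≼-refl ≼-trans step-≼ (suc fuel) x with step x in x↦y
  ... | just y  = ≼-trans (step-≼ x↦y) (iterate-preserves ≼-refl ≼-trans step-≼ fuel y)
  ... | nothing = ≼-refl

  module _ (μ : A → ℕ) (step-increases : ∀ {x y} → step x ≡ just y → μ x < μ y) where

    iterate-stops-or-increases : ∀ fuel x →
                                 step (iterate fuel x) ≡ nothing ⊎ fuel + μ x ≤ μ (iterate fuel x)
    iterate-stops-or-increases zero x = inj₂ ℕP.≤-refl
    iterate-stops-or-increases (suc fuel) x with step x in x↦y
    ... | nothing = inj₁ x↦y
    ... | just y with iterate-stops-or-increases fuel y
    ...   | inj₁ stops     = inj₁ stops
    ...   | inj₂ increases = inj₂ (begin
      suc fuel + μ x     ≡⟨ ℕP.+-suc fuel (μ x) ⟨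
      fuel + suc (μ x)   ≤⟨ ℕP.+-monoʳ-≤ fuel (step-increases x↦y) ⟩
      fuel + μ y         ≤⟨ increases ⟩
      μ (iterate fuel y) ∎)
      where open ℕP.≤-Reasoning

    iterate-stops : ∀ {bound} → (∀ x → μ x ≤ bound) → ∀ x → step (iterate (suc bound) x) ≡ nothing
    iterate-stops {bound} μ≤bound x with iterate-stops-or-increases (suc bound) x
    ... | inj₁ stops     = stops
    ... | inj₂ increases =
      ⊥-elim (ℕP.<⇒≱ (ℕP.<-≤-trans (s≤s (ℕP.m≤m+n bound _)) increases) (μ≤bound _))

module _ (M : Structure n) (k : ℕ) where

  Closed : Subset n → Set
  Closed X = Tstep M k X ≡ nothing

  Tstep-grows : ∀ {X X′} → Tstep M k X ≡ just X′ → X ⊆ X′ × numClasses M X < numClasses M X′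
  Tstep-grows {X} _ with filter (Admissible? M k X) (lexSets n) in admissibles
  Tstep-grows {X} refl | S ∷ _ =
    SubsetP.p⊆p∪q _ , proj₂ (proj₂ (proj₂ (∈-filter⁻ (Admissible? M k X) {xs = lexSets n}
                                      (subst (S ∈ₗ_) (sym admissibles) (here refl)))))

  Closed⇒¬Admissible : ∀ {X} → Closed X → ∀ {S} → S ∈ₗ lexSets n → ¬ Admissible M k X S
  Closed⇒¬Admissible {X} _ {S} S∈ adm with filter (Admissible? M k X) (lexSets n) in admissibles
  Closed⇒¬Admissible {X} _ {S} S∈ adm | [] =
    case subst (S ∈ₗ_) admissibles (∈-filter⁺ (Admissible? M k X) S∈ adm) of λ ()

  open Iteration (Tstep M k)

  -- Stated for iterT itself, the iteration lemmas would make with-abstraction evaluate Tstep.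
  iterT≡iterate : ∀ fuel X → iterT M k fuel X ≡ iterate fuel X
  iterT≡iterate zero       X = refl
  iterT≡iterate (suc fuel) X with Tstep M k X
  ... | just X′ = iterT≡iterate fuel X′
  ... | nothing = refl

  Eclos-extensive : ∀ X → X ⊆ Eclos M k X
  Eclos-extensive X = subst (X ⊆_) (sym (iterT≡iterate (suc n) X))
    (iterate-preserves {_≼_ = _⊆_} id (λ X⊆Y Y⊆Z → Y⊆Z ∘ X⊆Y) (proj₁ ∘ Tstep-grows) (suc n) X)

  Eclos-closed : ∀ X → Closed (Eclos M k X)
  Eclos-closed X = subst Closed (sym (iterT≡iterate (suc n) X))
    (iterate-stops (numClasses M) (proj₂ ∘ Tstep-grows) (λ _ → count≤n (IsLeastRep? M _)) X)

  ∈-Yset⁻ : ∀ {X v} → v ∈ Yset M k X → v ∉ X × classSize M X v ≤ suc k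
  ∈-Yset⁻ {X} {v} v∈Y =
    let v∉X , v-small = Equivalence.to T-∧ (Equivalence.from T-≡
                          (trans (sym (VecP.lookup∘tabulate _ v)) (VecP.[]=⇒lookup v∈Y)))
    in toWitness {a? = ¬∈? v X} v∉X , toWitness {a? = classSize M X v ℕ.≤? suc k} v-small

  ∈-Yset⁺ : ∀ {X v} → v ∉ X → classSize M X v ≤ suc k → v ∈ Yset M k X
  ∈-Yset⁺ {X} {v} v∉X v-small = VecP.lookup⇒[]= v _ (trans (VecP.lookup∘tabulate _ v)
    (Equivalence.to T-≡ (Equivalence.from T-∧
      (fromWitness {a? = ¬∈? v X} v∉X , fromWitness {a? = classSize M X v ℕ.≤? suc k} v-small))))

  ∉-Yset⁻ : ∀ {X v} → v ∉ X → v ∉ Yset M k X → suc k < classSize M X v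
  ∉-Yset⁻ {X} {v} v∉X v∉Y with classSize M X v ℕ.≤? suc k
  ... | yes v-small = ⊥-elim (v∉Y (∈-Yset⁺ v∉X v-small))
  ... | no v-big    = ℕP.≰⇒> v-big

module _ {C : ℕ → Subset n} (C-mono : ∀ i → C i ⊆ C (suc i)) (xs : List (Fin n)) where

  Stalls : ℕ → Set
  Stalls i = ¬ Any (λ x → x ∈ C (suc i) × x ∉ C i) xs

  stalls-or-grows : ∀ m → (∃[ i ] i < m × Stalls i) ⊎ m ≤ length (filter (_∈? C m) xs)
  stalls-or-grows zero = inj₂ z≤n
  stalls-or-grows (suc m) with stalls-or-grows m
  ... | inj₁ (i , i<m , stalls) = inj₁ (i , ℕP.m<n⇒m<1+n i<m , stalls)
  ... | inj₂ grown with Any.any? (λ x → x ∈? C (suc m) ×-dec ¬? (x ∈? C m)) xs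
  ...   | no stalls = inj₁ (m , ℕP.n<1+n m , stalls)
  ...   | yes new with find new
  ...     | x , x∈xs , x∈C′ , x∉C = inj₂ (ℕP.≤-<-trans grown
                (length-filter-mono-< (_∈? C m) (_∈? C (suc m)) (C-mono m) x∈xs x∉C x∈C′))

  chain-stalls : ∀ {m} → length xs < m → ∃[ i ] i < m × Stalls i
  chain-stalls {m} xs<m with stalls-or-grows m
  ... | inj₁ stalls = stalls
  ... | inj₂ grown  = ⊥-elim (ℕP.<⇒≱ xs<m (ℕP.≤-trans grown (ListP.length-filter _ xs)))

module _ (M : Structure n) (k : ℕ) where

  closed-classes-≤ : ∀ {X} → Closed M k X → ∀ {S} → LAll.All (_∉ X) S → length S ≤ k ∸ 1 →
                     numClasses M (X ∪ toSubset S) ≤ numClasses M X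
  closed-classes-≤ {X} closed {S} S∩X≡∅ S-small = ℕP.≮⇒≥ λ more-classes →
    Closed⇒¬Admissible M k closed (∈-lexSets (elements-increasing (toSubset S)))
      ( LAll.tabulate (LAll.lookup S∩X≡∅ ∘ toSubset-∈⁻ ∘ ∈-elements⁻)
      , ℕP.≤-trans (count-≤-length (_∈? toSubset S) (toSubset-∈⁻ {xs = S})) S-small
      , subst (λ T → numClasses M X < numClasses M (X ∪ T))
              (sym (toSubset-elements (toSubset S))) more-classes)

  split-classes-< : ∀ {X S} → (∀ {s} → s ∈ₗ S → length S < classSize M X s) →
                    ∀ {u v} → u ∉ₗ S → v ∉ₗ S → EquivAt M X u v → ¬ EquivAt M (X ∪ toSubset S) u v →
                    numClasses M X < numClasses M (X ∪ toSubset S)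
  split-classes-< {X} {S} S-in-big-classes u∉S v∉S Euv ¬E′uv
    rewrite numClasses≡#classes M X | numClasses≡#classes M (X ∪ toSubset S) =
    Refinement.#classes-< (EquivAt? M X) (EquivAt? M (X ∪ toSubset S))
      (EquivAt-isPartialEquivalence M X) (EquivAt-isPartialEquivalence M (X ∪ toSubset S))
      (EquivAt-antitone M (SubsetP.p⊆p∪q _)) cover
      Euv (EquivAt-refl M (∉-∪ (proj₁ Euv) u∉S)) (EquivAt-refl M (∉-∪ (proj₁ (proj₂ Euv)) v∉S))
      ¬E′uv
    where
    ∉-∪ : ∀ {x} → x ∉ X → x ∉ₗ S → x ∉ X ∪ toSubset S
    ∉-∪ x∉X x∉S x∈ with SubsetP.x∈p∪q⁻ X _ x∈
    ... | inj₁ x∈X = x∉X x∈X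
    ... | inj₂ x∈S = x∉S (toSubset-∈⁻ x∈S)
    cover : ∀ {r} → EquivAt M X r r → ∃[ m ] EquivAt M X m r × EquivAt M (X ∪ toSubset S) m m
    cover {r} Err with r ∈ₗ? S
    ... | no r∉S = r , Err , EquivAt-refl M (∉-∪ (proj₁ Err) r∉S)
    ... | yes r∈S with count-escapes (λ w → EquivAt? M X w r) (S-in-big-classes r∈S)
    ...   | m , Emr , m∉S = m , Emr , EquivAt-refl M (∉-∪ (proj₁ Emr) m∉S)

  closed-no-split : ∀ {X} → Closed M k X → ∀ {S} → LAll.All (_∉ X) S → length S ≤ k ∸ 1 →
                    (∀ {s} → s ∈ₗ S → length S < classSize M X s) →
                    ∀ {u v} → u ∉ₗ S → v ∉ₗ S → EquivAt M X u v → EquivAt M (X ∪ toSubset S) u v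
  closed-no-split {X} closed {S} S∩X≡∅ S-small S-big {u} {v} u∉S v∉S Euv
    with EquivAt? M (X ∪ toSubset S) u v
  ... | yes E′uv = E′uv
  ... | no ¬E′uv = ⊥-elim (ℕP.<⇒≱ (split-classes-< S-big u∉S v∉S Euv ¬E′uv)
                                  (closed-classes-≤ closed S∩X≡∅ S-small))

  U : ℕ → Subset n
  U i = Xseq M k i ∪ Yseq M k i

  U⊆X-suc : ∀ i → U i ⊆ Xseq M k (suc i)
  U⊆X-suc i = Eclos-extensive M k (U i)

  U-mono : ∀ i → U i ⊆ U (suc i)
  U-mono i = SubsetP.p⊆p∪q (Yseq M k (suc i)) ∘ U⊆X-suc i

  X-mono : ∀ {i j} → i ≤′ j → Xseq M k i ⊆ Xseq M k j
  X-mono ≤′-refl                    = id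
  X-mono {j = suc j} (≤′-step i≤j) = U⊆X-suc j ∘ SubsetP.p⊆p∪q (Yseq M k j) ∘ X-mono i≤j

  -- With (U i) in place of _ the conversion check evaluates Tstep and does not terminate in practice.
  X-suc-closed : ∀ i → Closed M k (Xseq M k (suc i))
  X-suc-closed i = Eclos-closed M k _

  Y-suc-new : ∀ i {x} → x ∈ Yseq M k (suc i) → x ∈ U (suc i) × x ∉ U i
  Y-suc-new i x∈Y = SubsetP.q⊆p∪q (Xseq M k (suc i)) (Yseq M k (suc i)) x∈Y ,
                    proj₁ (∈-Yset⁻ M k {X = Xseq M k (suc i)} x∈Y) ∘ U⊆X-suc i

  some-stage-avoids-Y : ∀ {xs} → length xs < k → ∃[ i ] i < k × LAll.All (_∉ Yseq M k (suc i)) xs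
  some-stage-avoids-Y {xs} xs<k =
    let i , i<k , stalls = chain-stalls {C = U} U-mono xs xs<k
    in i , i<k , LAll.tabulate λ {x} x∈xs x∈Y →
         stalls (Any.map (λ { refl → Y-suc-new i {x} x∈Y }) x∈xs)

without : Fin n → List (Fin n) → List (Fin n)
without u = filter (λ x → ¬? (x FinP.≟ u))

∉-without : ∀ {u : Fin n} xs → u ∉ₗ without u xs
∉-without xs u∈ = proj₂ (∈-filter⁻ _ {xs = xs} u∈) refl

∈-without⁻ : ∀ {u x : Fin n} xs → x ∈ₗ without u xs → x ∈ₗ xs
∈-without⁻ xs = proj₁ ∘ ∈-filter⁻ _ {xs = xs}

outside : Subset n → List (Fin n) → List (Fin n)
outside X = filter (λ x → ¬∈? x X)

∈-outside-without : ∀ (X : Subset n) {u xs x} → x ∈ₗ xs →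
                    x ∈ (X ∪ toSubset (outside X (without u xs))) ∪ ⁅ u ⁆
∈-outside-without X {u} {x = x} x∈xs with x FinP.≟ u
... | yes refl = ∈-∪⁅⁆ʳ
... | no x≢u with x ∈? X
...   | yes x∈X = ∈-∪⁅⁆ˡ (SubsetP.p⊆p∪q _ x∈X)
...   | no x∉X  =
  ∈-∪⁅⁆ˡ (SubsetP.q⊆p∪q X _ (toSubset-∈⁺ (∈-filter⁺ _ (∈-filter⁺ _ x∈xs x≢u) x∉X)))

big-class : ∀ (M : Structure n) k {a} → InZ M k a → 0 < k → suc k < classSize M (Xseq M k k) a
big-class M (suc k) a∉Xfinal _ = ∉-Yset⁻ M (suc k)
  (a∉Xfinal ∘ SubsetP.p⊆p∪q (Yseq M (suc k) (suc k)))
  (a∉Xfinal ∘ SubsetP.q⊆p∪q (Xseq M (suc k) (suc k)) (Yseq M (suc k) (suc k)))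

module _ (M : Structure n) (k : ℕ) where

  closed-extends : ∀ {X} → Closed M k X → ∀ {u v xs} → length xs ≤ k ∸ 1 →
                   LAll.All (_∉ Yset M k X) xs → u ∉ₗ xs → v ∉ₗ xs → EquivAt M X u v →
                   EquivAt M (X ∪ toSubset (outside X xs)) u v
  closed-extends {X} closed {xs = xs} xs-small xs-avoid-Y u∉xs v∉xs =
    closed-no-split M k closed (LAllP.all-filter (λ x → ¬∈? x X) xs) S-small S-big
      (u∉xs ∘ proj₁ ∘ ∈-filter⁻ _) (v∉xs ∘ proj₁ ∘ ∈-filter⁻ _)
    where
    S-small : length (outside X xs) ≤ k ∸ 1
    S-small = ℕP.≤-trans (ListP.length-filter _ xs) xs-small
    S-big : ∀ {s} → s ∈ₗ outside X xs → length (outside X xs) < classSize M X s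
    S-big s∈S = let s∈xs , s∉X = ∈-filter⁻ _ s∈S in
      ℕP.≤-<-trans (ℕP.≤-trans S-small (ℕP.m∸n≤m k 1))
        (ℕP.<-trans (ℕP.n<1+n k) (∉-Yset⁻ M k s∉X (LAll.lookup xs-avoid-Y s∈xs)))

  module _ (arity≤k : ∀ r → arity M r ≤ k) where

    move-preserves-rel : ∀ {u v} → EquivAt M (Xseq M k k) u v →
                         ∀ r (t : Vec (Fin n) (arity M r)) → v ∉ₗ Vec.toList t →
                         rel M r t ≡ rel M r (Vec.map (mapTo u v) t)
    move-preserves-rel {u} {v} Euv r t v∉t with u ∈ₗ? Vec.toList t
    ... | no u∉t = cong (rel M r) (sym (begin
      Vec.map (mapTo u v) t ≡⟨ map-cong-∈ t (λ x∈t → mapTo-≢ u v λ { refl → u∉t x∈t }) ⟩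
      Vec.map id t          ≡⟨ VecP.map-id t ⟩
      t                     ∎))
      where open ≡-Reasoning
    ... | yes u∈t = proj₂ (proj₂ moved) r t (All-∈ t (∈-outside-without Xᵢ))
      where
      xs : List (Fin n)
      xs = without u (Vec.toList t)
      xs<k : length xs < k
      xs<k = ℕP.<-≤-trans
        (ListP.filter-notAll _ _ (Any.map (λ { refl u≢u → u≢u refl }) u∈t))
        (ℕP.≤-trans (ℕP.≤-reflexive (VecP.length-toList t)) (arity≤k r))
      stage : ∃[ i ] i < k × LAll.All (_∉ Yseq M k (suc i)) xs
      stage = some-stage-avoids-Y M k xs<k
      i : ℕ
      i = proj₁ stage
      Xᵢ : Subset n
      Xᵢ = Xseq M k (suc i)
      moved : EquivAt M (Xᵢ ∪ toSubset (outside Xᵢ xs)) u v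
      moved = closed-extends (X-suc-closed M k i) (ℕP.∸-monoˡ-≤ 1 xs<k) (proj₂ (proj₂ stage))
        (∉-without (Vec.toList t)) (v∉t ∘ ∈-without⁻ (Vec.toList t))
        (EquivAt-antitone M (X-mono M k (ℕP.≤⇒≤′ (proj₁ (proj₂ stage)))) Euv)

    swap-via-third : ∀ {a b c} → a ≢ b → EquivAt M (Xseq M k k) a b → EquivAt M (Xseq M k k) c a →
                     ∀ r (t : Vec (Fin n) (arity M r)) →
                     a ∈ₗ Vec.toList t → b ∈ₗ Vec.toList t → c ∉ₗ Vec.toList t →
                     rel M r t ≡ rel M r (Vec.map (swap a b) t)
    swap-via-third {a} {b} {c} a≢b Eab Eca r t a∈t b∈t c∉t = begin
      rel M r t                        ≡⟨ move-preserves-rel (EquivAt-sym M Eca) r t c∉t ⟩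
      rel M r t₁                       ≡⟨ move-preserves-rel (EquivAt-sym M Eab) r t₁ (∉-map-mapTo c≢a t) ⟩
      rel M r t₂                       ≡⟨ move-preserves-rel (EquivAt-trans M Eca Eab) r t₂
                                                             (∉-map-mapTo a≢b t₁) ⟩
      rel M r (Vec.map (mapTo c b) t₂) ≡⟨ cong (rel M r) three-moves ⟩
      rel M r (Vec.map (swap a b) t)   ∎
      where
      open ≡-Reasoning
      c≢a : c ≢ a
      c≢a refl = c∉t a∈t
      c≢b : c ≢ b
      c≢b refl = c∉t b∈t
      t₁ t₂ : Vec (Fin n) (arity M r)
      t₁ = Vec.map (mapTo a c) t
      t₂ = Vec.map (mapTo b a) t₁
      three-moves : Vec.map (mapTo c b) t₂ ≡ Vec.map (swap a b) t
      three-moves = begin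
        Vec.map (mapTo c b) (Vec.map (mapTo b a) (Vec.map (mapTo a c) t))
          ≡⟨ cong (Vec.map (mapTo c b)) (VecP.map-∘ (mapTo b a) (mapTo a c) t) ⟨
        Vec.map (mapTo c b) (Vec.map (mapTo b a ∘ mapTo a c) t)
          ≡⟨ VecP.map-∘ (mapTo c b) (mapTo b a ∘ mapTo a c) t ⟨
        Vec.map (mapTo c b ∘ mapTo b a ∘ mapTo a c) t
          ≡⟨ map-cong-∈ t (λ {x} x∈t → three-moves≡swap c≢a c≢b {x} λ { refl → c∉t x∈t }) ⟩
        Vec.map (swap a b) t ∎

    Xₖ⇒Sim : ∀ {a b} → InZ M k a → EquivAt M (Xseq M k k) a b → Sim M a b
    Xₖ⇒Sim {a} {b} a∈Z Eab r t with a FinP.≟ b | b ∈ₗ? Vec.toList t | a ∈ₗ? Vec.toList t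
    ... | yes refl | _ | _ =
      cong (rel M r) (sym (trans (VecP.map-cong (swap-self a) t) (VecP.map-id t)))
    ... | no _ | no b∉t | _ = trans (move-preserves-rel Eab r t b∉t)
      (cong (rel M r) (map-cong-∈ t λ {x} x∈t → mapTo≡swap a b {x} λ { refl → b∉t x∈t }))
    ... | no _ | yes _ | no a∉t = trans (move-preserves-rel (EquivAt-sym M Eab) r t a∉t)
      (cong (rel M r) (map-cong-∈ t λ {x} x∈t → mapTo≡swap-flip a b {x} λ { refl → a∉t x∈t }))
    ... | no a≢b | yes b∈t | yes a∈t =
      let c , Eca , c∉t = count-escapes (λ w → EquivAt? M (Xseq M k k) w a) t<class
      in swap-via-third a≢b Eab Eca r t a∈t b∈t c∉t
      where
      arity>0 : ∀ {l} {xs : Vec (Fin n) l} → a ∈ₗ Vec.toList xs → 0 < l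
      arity>0 {xs = _ ∷ _} _ = ℕ.z<s
      t<class : length (Vec.toList t) < classSize M (Xseq M k k) a
      t<class = ℕP.<-trans (s≤s (ℕP.≤-trans (ℕP.≤-reflexive (VecP.length-toList t)) (arity≤k r)))
                           (big-class M k a∈Z (ℕP.<-≤-trans (arity>0 a∈t) (arity≤k r)))

lemma3p12 : ∀ {n} (M : Structure n) (k : ℕ) → MaxArity M k →
    ∀ (a b : Fin n) → InZ M k a → InZ M k b →
      (EquivAt M (Xseq M k k) a b ⇔ EquivAt M (Xfinal M k) a b) ×
      (EquivAt M (Xfinal M k) a b ⇔ Sim M a b)
lemma3p12 M k (arity≤k , _) a b a∈Z b∈Z =
  mk⇔ (Sim⇒Xfinal ∘ Xₖ⇒Sim′) Xfinal⇒Xₖ , mk⇔ (Xₖ⇒Sim′ ∘ Xfinal⇒Xₖ) Sim⇒Xfinal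
  where
  Xfinal⇒Xₖ : EquivAt M (Xfinal M k) a b → EquivAt M (Xseq M k k) a b
  Xfinal⇒Xₖ = EquivAt-antitone M (SubsetP.p⊆p∪q (Yseq M k k))
  Sim⇒Xfinal : Sim M a b → EquivAt M (Xfinal M k) a b
  Sim⇒Xfinal = Sim⇒EquivAt M a∈Z b∈Z
  Xₖ⇒Sim′ : EquivAt M (Xseq M k k) a b → Sim M a b
  Xₖ⇒Sim′ = Xₖ⇒Sim M k arity≤k a∈Z
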